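{- Let $T$ be a balanced tree with a proper 2-coloring into red and blue in which all leaves are blue. If there is a vertex $s\in V_1$ with $|N(s)\cap V_2|\ge 2$, then $T$ has two minimal red-dominating sets of different sizes, and hence $T$ is not well-totally dominated.
   Context: All graphs are finite and simple. $N(v)$ is the open neighborhood of $v$, $N(S)=\bigcup_{v\in S}N(v)$. A leaf is a vertex of degree 1; the height of a vertex is its minimum distance to a leaf; $V_k$ is the set of vertices of height $k$. A tree is balanced if no two vertices of the same height are adjacent. $V_\mathcal{R}$ is the set of red vertices. A red-dominating set (RDS) is a set $D$ with $N(D)=V_\mathcal{R}$; it is minimal if no proper subset $D'\subsetneq D$ has $N(D')=N(D)$. A total dominating set is a set $S$ with $N(S)=V(T)$; $T$ is well-totally dominated if all its inclusion-minimal total dominating sets have the same size. -}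

module Defs where

open import Data.Nat using (ℕ; zero; suc; _≤_; _+_)
open import Data.Bool using (Bool; true; false; T)
open import Data.Fin using (Fin; inject₁; fromℕ) renaming (zero to fzero; suc to fsuc)
open import Data.Fin.Subset using (Subset; _∈_; _⊂_; ∣_∣)
open import Data.Vec using (tabulate)
open import Data.Product using (Σ; ∃; _×_; _,_)
open import Data.Empty using (⊥)
open import Relation.Nullary using (¬_)
open import Relation.Binary.PropositionalEquality using (_≡_; _≢_)
open import Function using (_⇔_)
open import Function.Definitions using (Injective)

record Graph : Set where
  field
    n     : ℕ
    adj   : Fin n → Fin n → Bool
    sym   : ∀ u v → adj u v ≡ adj v u
    irrefl : ∀ v → adj v v ≡ false

module _ (G : Graph) where
  open Graph G

  Vertex : Set
  Vertex = Fin n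

  Adj : Vertex → Vertex → Set
  Adj u v = T (adj u v)

  data Walk : Vertex → Vertex → ℕ → Set where
    here : ∀ {v} → Walk v v 0
    step : ∀ {u w v k} → Adj u w → Walk w v k → Walk u v (suc k)

  Connected : Set
  Connected = ∀ u v → ∃ λ k → Walk u v k

  -- a cycle of length k+3: distinct vertices c 0, ..., c (k+2), consecutive
  -- ones adjacent and c (k+2) adjacent to c 0
  record Cycle : Set where
    field
      k      : ℕ
      c      : Fin (suc (suc (suc k))) → Vertex
      inj    : Injective _≡_ _≡_ c
      edges  : ∀ (i : Fin (suc (suc k))) → Adj (c (inject₁ i)) (c (fsuc i))
      close  : Adj (c (fromℕ (suc (suc k)))) (c fzero)

  Acyclic : Set
  Acyclic = ¬ Cycle

  IsTree : Set
  IsTree = Connected × Acyclic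

  Nbhd : Vertex → Subset n
  Nbhd v = tabulate (adj v)

  degree : Vertex → ℕ
  degree v = ∣ Nbhd v ∣

  Leaf : Vertex → Set
  Leaf v = degree v ≡ 1

  -- height v ≡ h : minimum distance from v to a leaf is h
  -- (the shortest walk length equals the distance)
  HasHeight : Vertex → ℕ → Set
  HasHeight v h = (∃ λ l → Leaf l × Walk v l h)
                × (∀ l j → Leaf l → Walk v l j → h ≤ j)

  Balanced : Set
  Balanced = ∀ u v h → Adj u v → HasHeight u h → HasHeight v h → ⊥

  InN : Subset n → Vertex → Set
  InN S v = ∃ λ u → u ∈ S × Adj u v

  SameN : Subset n → Subset n → Set
  SameN S S' = ∀ v → InN S v ⇔ InN S' v

  -- proper 2-colouring: colour v ≡ true means red, false means blue
  ProperColouring : (Vertex → Bool) → Set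
  ProperColouring col = ∀ u v → Adj u v → col u ≢ col v

  Red : (Vertex → Bool) → Vertex → Set
  Red col v = col v ≡ true

  IsRDS : (Vertex → Bool) → Subset n → Set
  IsRDS col D = ∀ v → InN D v ⇔ Red col v

  IsMinimalRDS : (Vertex → Bool) → Subset n → Set
  IsMinimalRDS col D = IsRDS col D × (∀ D' → D' ⊂ D → ¬ SameN D' D)

  IsTDS : Subset n → Set
  IsTDS S = ∀ v → InN S v

  IsMinimalTDS : Subset n → Set
  IsMinimalTDS S = IsTDS S × (∀ S' → S' ⊂ S → ¬ IsTDS S')

  WellTotallyDominated : Set
  WellTotallyDominated = ∀ S S' → IsMinimalTDS S → IsMinimalTDS S' → ∣ S ∣ ≡ ∣ S' ∣

  -- |N(s) ∩ V_2| ≥ 2 : two distinct neighbours of s of height 2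
  TwoHeight2Nbrs : Vertex → Set
  TwoHeight2Nbrs s = Σ Vertex λ a → Σ Vertex λ b →
    a ≢ b × Adj s a × Adj s b × HasHeight a 2 × HasHeight b 2

-- Let ℓ be a leaf at s and a, b two non-leaf neighbours of s; s is red because ℓ is blue.
-- A blue set is a minimal red-dominating set as soon as it dominates every red vertex and
-- each of its vertices has a private red neighbour, and such sets can be assembled piece by
-- piece: removing s cuts the tree into the branches at a and at b and the rest, and a red
-- vertex other than s has all its blue neighbours in its own piece. In the branch at x we
-- take two irredundant dominators X_x ∋ x and Y_x ⊆ V ∖ N(s) of its red vertices, and in the
-- rest one, W ⊆ V ∖ N(s), of its red vertices other than s (in a tree without 4-cycles a red
-- vertex always has a neighbour missing any prescribed other vertex). Then
--   X_a ∪ X_b ∪ W,  X_a ∪ Y_b ∪ W,  Y_a ∪ X_b ∪ W,  Y_a ∪ Y_b ∪ W ∪ {ℓ}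
-- are minimal red-dominating sets, and the sizes of the first and last add up to one more
-- than those of the middle two, so two of them differ. Adding one minimal red dominator of
-- the blue vertices to each gives minimal total dominating sets with the same difference.

module Submission where

open import Defs
open import Data.Bool using (Bool; true; false; T) renaming (_≟_ to _≟ᵇ_)
open import Data.Empty using (⊥-elim)
open import Data.Fin using (Fin; _≟_; inject₁; fromℕ) renaming (zero to fzero; suc to fsuc)
open import Data.Fin.Properties using (any?; all?)
open import Data.Fin.Subset using (Subset; _∈_; _∉_; _⊆_; _⊂_; _∪_; _-_; ⁅_⁆; ∣_∣; ⊥; inside; outside)
open import Data.Fin.Subset.Induction using (⊂-wellFounded; Acc; acc)
open import Data.Fin.Subset.Properties
  using (_∈?_; ⊆-refl; ⊆-antisym; p─q⊆p; x∈p∧x≢y⇒x∈p-y; x∈p⇒p-x⊂p; x∈p⇒∣p-x∣<∣p∣;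
         p⊆q⇒∣p∣≤∣q∣; x∈⁅x⁆; x∈⁅y⁆⇒x≡y; ∣⁅x⁆∣≡1; x∈p∪q⁺; x∈p∪q⁻; p⊆p∪q; q⊆p∪q; ∉⊥; ∣⊥∣≡0)
open import Data.Nat using (suc; _+_; _≤_; _<_) renaming (_≟_ to _≟ℕ_)
open import Data.Nat.Tactic.RingSolver using (solve-∀)
open import Data.Nat.Properties using (+-suc; ≤⇒≯; +-cancelʳ-≡; 1+n≢n)
open import Data.List using (List; []; _∷_; length; lookup)
open import Data.List.Membership.Propositional using () renaming (_∈_ to _∈ₗ_; _∉_ to _∉ₗ_)
open import Data.List.Membership.Propositional.Properties using (∈-lookup)
open import Data.List.Relation.Unary.Any using (here; there)
open import Data.Product using (Σ; ∃; ∃₂; _×_; _,_; proj₁; proj₂)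
open import Data.Sum as Sum using (_⊎_; inj₁; inj₂)
open import Data.Vec using ([]; _∷_; tabulate; here; there)
open import Data.Vec.Properties using ([]=⇒lookup; lookup⇒[]=; lookup∘tabulate)
open import Function using (_∘_; flip; mk⇔; Equivalence)
open import Level using (0ℓ)
open import Relation.Nullary using (¬_; Dec; yes; no; does)
open import Relation.Nullary.Decidable using (T?; _×-dec_; _⊎-dec_; _→-dec_; ¬?; decidable-stable; dec-true)
open import Relation.Unary using (Pred; Decidable; U)
open import Relation.Binary.PropositionalEquality using (_≡_; _≢_; refl; sym; trans; cong; cong₂; subst; module ≡-Reasoning)

subset : ∀ {n} {P : Pred (Fin n) 0ℓ} → Decidable P → Subset n
subset P? = tabulate (does ∘ P?)

module _ {n} {P : Pred (Fin n) 0ℓ} (P? : Decidable P) {x : Fin n} where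

  ∈-subset⁺ : P x → x ∈ subset P?
  ∈-subset⁺ px = lookup⇒[]= x _ (trans (lookup∘tabulate _ x) (dec-true (P? x) px))

  ∈-subset⁻ : x ∈ subset P? → P x
  ∈-subset⁻ x∈ = yes⇒ (P? x) (trans (sym (lookup∘tabulate _ x)) ([]=⇒lookup x∈))
    where
    yes⇒ : (d : Dec (P x)) → does d ≡ true → P x
    yes⇒ (yes px) _ = px

module _ {n} {p : Subset n} {x : Fin n} where

  ∣p∣≡1⇒∈-unique : ∣ p ∣ ≡ 1 → x ∈ p → ∀ {y} → y ∈ p → y ≡ x
  ∣p∣≡1⇒∈-unique ∣p∣≡1 x∈p {y} y∈p with y ≟ x
  ... | yes y≡x = y≡x
  ... | no y≢x = ⊥-elim (≤⇒≯ 1≤∣p-x∣ (subst (∣ p - x ∣ <_) ∣p∣≡1 (x∈p⇒∣p-x∣<∣p∣ x∈p)))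
    where
    1≤∣p-x∣ : 1 ≤ ∣ p - x ∣
    1≤∣p-x∣ = subst (_≤ ∣ p - x ∣) (∣⁅x⁆∣≡1 y)
      (p⊆q⇒∣p∣≤∣q∣ (λ z∈⁅y⁆ → subst (_∈ p - x) (sym (x∈⁅y⁆⇒x≡y y z∈⁅y⁆)) (x∈p∧x≢y⇒x∈p-y y∈p y≢x)))

  ∈-unique⇒∣p∣≡1 : x ∈ p → (∀ {y} → y ∈ p → y ≡ x) → ∣ p ∣ ≡ 1
  ∈-unique⇒∣p∣≡1 x∈p unique = trans (cong ∣_∣ p≡⁅x⁆) (∣⁅x⁆∣≡1 x)
    where
    p≡⁅x⁆ : p ≡ ⁅ x ⁆
    p≡⁅x⁆ = ⊆-antisym (λ y∈p → subst (_∈ ⁅ x ⁆) (sym (unique y∈p)) (x∈⁅x⁆ x))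
                      (λ y∈⁅x⁆ → subst (_∈ p) (sym (x∈⁅y⁆⇒x≡y x y∈⁅x⁆)) x∈p)

∣p∪q∣≡∣p∣+∣q∣ : ∀ {n} (p q : Subset n) → (∀ {x} → x ∈ p → x ∉ q) → ∣ p ∪ q ∣ ≡ ∣ p ∣ + ∣ q ∣
∣p∪q∣≡∣p∣+∣q∣ []            []            _        = refl
∣p∪q∣≡∣p∣+∣q∣ (inside  ∷ p) (inside  ∷ q) disjoint = ⊥-elim (disjoint here here)
∣p∪q∣≡∣p∣+∣q∣ (inside  ∷ p) (outside ∷ q) disjoint =
  cong suc (∣p∪q∣≡∣p∣+∣q∣ p q (λ x∈p x∈q → disjoint (there x∈p) (there x∈q)))
∣p∪q∣≡∣p∣+∣q∣ (outside ∷ p) (inside  ∷ q) disjoint =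
  trans (cong suc (∣p∪q∣≡∣p∣+∣q∣ p q (λ x∈p x∈q → disjoint (there x∈p) (there x∈q)))) (sym (+-suc ∣ p ∣ ∣ q ∣))
∣p∪q∣≡∣p∣+∣q∣ (outside ∷ p) (outside ∷ q) disjoint =
  ∣p∪q∣≡∣p∣+∣q∣ p q (λ x∈p x∈q → disjoint (there x∈p) (there x∈q))

UnequalPair : ∀ {n} → (Subset n → Set) → Set
UnequalPair P = ∃₂ λ D₁ D₂ → P D₁ × P D₂ × ∣ D₁ ∣ ≢ ∣ D₂ ∣

unequal-pair : ∀ {n} {P : Subset n → Set} {D₁ D₂ D₃ D₄} → P D₁ → P D₂ → P D₃ → P D₄ →
               ∣ D₁ ∣ + ∣ D₄ ∣ ≡ suc (∣ D₂ ∣ + ∣ D₃ ∣) → UnequalPair P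
unequal-pair {D₁ = D₁} {D₂} {D₃} {D₄} p₁ p₂ p₃ p₄ crossed with ∣ D₁ ∣ ≟ℕ ∣ D₂ ∣ | ∣ D₁ ∣ ≟ℕ ∣ D₃ ∣
... | no ∣D₁∣≢∣D₂∣ | _ = D₁ , D₂ , p₁ , p₂ , ∣D₁∣≢∣D₂∣
... | yes _ | no ∣D₁∣≢∣D₃∣ = D₁ , D₃ , p₁ , p₃ , ∣D₁∣≢∣D₃∣
... | yes ∣D₁∣≡∣D₂∣ | yes ∣D₁∣≡∣D₃∣ = D₄ , D₁ , p₄ , p₁ , λ ∣D₄∣≡∣D₁∣ → 1+n≢n (sym (begin
  ∣ D₁ ∣ + ∣ D₁ ∣          ≡⟨ cong (∣ D₁ ∣ +_) (sym ∣D₄∣≡∣D₁∣) ⟩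
  ∣ D₁ ∣ + ∣ D₄ ∣          ≡⟨ crossed ⟩
  suc (∣ D₂ ∣ + ∣ D₃ ∣)    ≡⟨ cong₂ (λ m k → suc (m + k)) (sym ∣D₁∣≡∣D₂∣) (sym ∣D₁∣≡∣D₃∣) ⟩
  suc (∣ D₁ ∣ + ∣ D₁ ∣)    ∎))
  where open ≡-Reasoning

crossed-sums : ∀ xa ya xb yb w e → xa + (xb + (w + e)) + (ya + (yb + (w + suc e))) ≡
                                    suc (xa + (yb + (w + e)) + (ya + (xb + (w + e))))
crossed-sums = solve-∀

module Neighbours (G : Graph) where
  open Graph G using (n; adj) renaming (sym to adj-sym; irrefl to adj-irrefl)

  private
    variable
      u v x y : Vertex G
      D D' : Subset n

  Adj-sym : Adj G u v → Adj G v u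
  Adj-sym {u} {v} = subst T (adj-sym u v)

  Adj⇒≢ : Adj G u v → u ≢ v
  Adj⇒≢ {u} u~u refl = subst T (adj-irrefl u) u~u

  Adj? : ∀ u v → Dec (Adj G u v)
  Adj? u v = T? (adj u v)

  InN-mono : D ⊆ D' → InN G D v → InN G D' v
  InN-mono D⊆D' (u , u∈D , u~v) = u , D⊆D' u∈D , u~v

  -- Nbhd G v is subset (Adj? v) by computation, since does (T? b) reduces to b.
  ∈-Nbhd⁺ : Adj G v x → x ∈ Nbhd G v
  ∈-Nbhd⁺ {v} = ∈-subset⁺ (Adj? v)

  ∈-Nbhd⁻ : x ∈ Nbhd G v → Adj G v x
  ∈-Nbhd⁻ {v = v} = ∈-subset⁻ (Adj? v)

  leaf-neighbour-unique : Leaf G v → Adj G v x → Adj G v y → y ≡ x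
  leaf-neighbour-unique leaf v~x v~y = ∣p∣≡1⇒∈-unique leaf (∈-Nbhd⁺ v~x) (∈-Nbhd⁺ v~y)

  ¬leaf⇒other-neighbour : ¬ Leaf G v → Adj G v x → ∃ λ y → Adj G v y × y ≢ x
  ¬leaf⇒other-neighbour {v} {x} ¬leaf v~x with any? (λ y → Adj? v y ×-dec ¬? (y ≟ x))
  ... | yes other = other
  ... | no none = ⊥-elim (¬leaf (∈-unique⇒∣p∣≡1 (∈-Nbhd⁺ v~x) only))
    where
    only : ∀ {y} → y ∈ Nbhd G v → y ≡ x
    only {y} y∈N = decidable-stable (y ≟ x) λ y≢x → none (y , ∈-Nbhd⁻ y∈N , y≢x)

  connected⇒neighbour : Connected G → u ≢ v → ∃ (Adj G u)
  connected⇒neighbour {u} {v} connected u≢v with connected u v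
  ... | _ , here = ⊥-elim (u≢v refl)
  ... | _ , step u~w _ = _ , u~w

  height-1⇒leaf-neighbour : HasHeight G v 1 → ∃ λ ℓ → Leaf G ℓ × Adj G v ℓ
  height-1⇒leaf-neighbour ((ℓ , leaf , step v~ℓ here) , _) = ℓ , leaf , v~ℓ

  positive-height⇒¬leaf : ∀ {h} → HasHeight G v (suc h) → ¬ Leaf G v
  positive-height⇒¬leaf (_ , minimal) leaf with minimal _ 0 leaf here
  ... | ()

module Domination (G : Graph) where
  open Graph G using (n)
  open Neighbours G

  private
    V = Vertex G
    variable
      x p : V
      D D' S : Subset n
      Q : Pred V 0ℓ

  Dominates : Subset n → Pred V 0ℓ → Set
  Dominates D Q = ∀ {q} → Q q → InN G D q

  PrivateNeighbour : Subset n → V → V → Set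
  PrivateNeighbour D x p = Adj G x p × (∀ y → y ∈ D → Adj G y p → y ≡ x)

  Irredundant : Pred V 0ℓ → Subset n → Set
  Irredundant Q D = ∀ {x} → x ∈ D → ∃ λ p → Q p × PrivateNeighbour D x p

  private-transfer : PrivateNeighbour S x p → (∀ {y} → y ∈ D → Adj G y p → y ∈ S) → PrivateNeighbour D x p
  private-transfer (x~p , only) local = x~p , λ y y∈D y~p → only y (local y∈D y~p) y~p

  irredundant⇒minimal : Irredundant Q D → D' ⊂ D → ¬ (∀ v → InN G D v → InN G D' v)
  irredundant⇒minimal irr (D'⊆D , x , x∈D , x∉D') N[D]⊆N[D'] with irr x∈D
  ... | p , _ , x~p , only with N[D]⊆N[D'] p (x , x∈D , x~p)
  ... | y , y∈D' , y~p = x∉D' (subst (_∈ _) (only y (D'⊆D y∈D') y~p) y∈D')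

  module _ (Q? : Decidable Q) where

    private-neighbour? : ∀ D x → Dec (∃ λ p → Q p × PrivateNeighbour D x p)
    private-neighbour? D x =
      any? λ p → Q? p ×-dec Adj? x p ×-dec all? λ y → y ∈? D →-dec Adj? y p →-dec y ≟ x

    dominates-without : Dominates D Q → ¬ (∃ λ p → Q p × PrivateNeighbour D x p) → Dominates (D - x) Q
    dominates-without {D} {x} dom no-private {q} Qq with dom Qq
    ... | u , u∈D , u~q with u ≟ x
    ...   | no u≢x = u , x∈p∧x≢y⇒x∈p-y u∈D u≢x , u~q
    ...   | yes refl with any? (λ y → y ∈? D ×-dec Adj? y q ×-dec ¬? (y ≟ u))
    ...     | yes (y , y∈D , y~q , y≢u) = y , x∈p∧x≢y⇒x∈p-y y∈D y≢u , y~q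
    ...     | no none = ⊥-elim (no-private (q , Qq , u~q , only))
      where
      only : ∀ y → y ∈ D → Adj G y q → y ≡ u
      only y y∈D y~q = decidable-stable (y ≟ u) λ y≢u → none (y , y∈D , y~q , y≢u)

    irredundant-subset : ∀ S → Dominates S Q → ∃ λ D → D ⊆ S × Dominates D Q × Irredundant Q D
    irredundant-subset S = go S (⊂-wellFounded S)
      where
      go : ∀ S → Acc _⊂_ S → Dominates S Q → ∃ λ D → D ⊆ S × Dominates D Q × Irredundant Q D
      go S (acc smaller) dom with any? (λ x → x ∈? S ×-dec ¬? (private-neighbour? S x))
      ... | yes (x , x∈S , no-private) =
        let D , D⊆S-x , rest = go (S - x) (smaller (x∈p⇒p-x⊂p x∈S)) (dominates-without dom no-private)
        in  D , p─q⊆p S ⁅ x ⁆ ∘ D⊆S-x , rest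
      ... | no none = S , ⊆-refl , dom ,
                      λ {x} x∈S → decidable-stable (private-neighbour? S x) λ np → none (x , x∈S , np)

module Branches (G : Graph) where
  open Graph G using (n)
  open import Data.List.Membership.DecPropositional (_≟_ {n}) using () renaming (_∈?_ to _∈ₗ?_)
  open Neighbours G

  private
    V = Vertex G
    variable
      u v w x y z : V

  data AvoidingWalk (s : V) : V → V → Set where
    [_] : v ≢ s → AvoidingWalk s v v
    cons : u ≢ s → Adj G u w → AvoidingWalk s w v → AvoidingWalk s u v

  Branch : V → V → Pred V 0ℓ
  Branch s x = AvoidingWalk s x

  data SimplePath (s : V) : V → V → List V → Set where
    [_] : v ≢ s → SimplePath s v v []
    cons : ∀ {xs} → u ≢ s → Adj G u w → u ∉ₗ w ∷ xs → SimplePath s w v xs → SimplePath s u v (w ∷ xs)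

  module _ {s : V} where

    end≢s : AvoidingWalk s u v → v ≢ s
    end≢s [ v≢s ] = v≢s
    end≢s (cons _ _ walk) = end≢s walk

    _++_ : AvoidingWalk s u v → AvoidingWalk s v w → AvoidingWalk s u w
    [ _ ] ++ walk' = walk'
    cons u≢s u~w walk ++ walk' = cons u≢s u~w (walk ++ walk')

    extend : AvoidingWalk s u v → Adj G v w → w ≢ s → AvoidingWalk s u w
    extend walk v~w w≢s = walk ++ cons (end≢s walk) v~w [ w≢s ]

    reverse : AvoidingWalk s u v → AvoidingWalk s v u
    reverse [ v≢s ] = [ v≢s ]
    reverse (cons u≢s u~w walk) = extend (reverse walk) (Adj-sym u~w) u≢s

    suffix : ∀ {xs} → SimplePath s u v xs → x ∈ₗ u ∷ xs → ∃ (SimplePath s x v)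
    suffix path (here refl) = _ , path
    suffix (cons _ _ _ path) (there x∈xs) = suffix path x∈xs

    loop-erase : AvoidingWalk s u v → ∃ (SimplePath s u v)
    loop-erase [ v≢s ] = [] , [ v≢s ]
    loop-erase (cons {u} u≢s u~w walk) with loop-erase walk
    ... | xs , path with u ∈ₗ? _ ∷ xs
    ...   | yes u∈ = suffix path u∈
    ...   | no u∉ = _ , cons u≢s u~w u∉ path

    path-avoids : ∀ {xs} → SimplePath s u v xs → x ∈ₗ u ∷ xs → x ≢ s
    path-avoids [ v≢s ] (here refl) = v≢s
    path-avoids (cons u≢s _ _ _) (here refl) = u≢s
    path-avoids (cons _ _ _ path) (there x∈xs) = path-avoids path x∈xs

    path-injective : ∀ {xs} → SimplePath s u v xs → ∀ i j → lookup (u ∷ xs) i ≡ lookup (u ∷ xs) j → i ≡ j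
    path-injective _ fzero fzero _ = refl
    path-injective (cons _ _ u∉ _) fzero (fsuc j) u≡ = ⊥-elim (u∉ (subst (_∈ₗ _) (sym u≡) (∈-lookup j)))
    path-injective (cons _ _ u∉ _) (fsuc i) fzero ≡u = ⊥-elim (u∉ (subst (_∈ₗ _) ≡u (∈-lookup i)))
    path-injective (cons _ _ _ path) (fsuc i) (fsuc j) eq = cong fsuc (path-injective path i j eq)

    path-edge : ∀ {xs} → SimplePath s u v xs → (i : Fin (length xs)) →
                Adj G (lookup (u ∷ xs) (inject₁ i)) (lookup (u ∷ xs) (fsuc i))
    path-edge (cons _ u~w _ _) fzero = u~w
    path-edge (cons _ _ _ path) (fsuc i) = path-edge path i

    path-last : ∀ {xs} → SimplePath s u v xs → lookup (u ∷ xs) (fromℕ (length xs)) ≡ v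
    path-last [ _ ] = refl
    path-last (cons _ _ _ path) = path-last path

    cycle : ∀ {xs} → x ≢ y → Adj G s x → Adj G s y → SimplePath s x y xs → Cycle G
    cycle x≢y _ _ [ _ ] = ⊥-elim (x≢y refl)
    cycle {x} {y} {w ∷ rest} _ s~x s~y path = record
      { k = length rest
      ; c = lookup cyc
      ; inj = λ {i} {j} → injective i j
      ; edges = edges
      ; close = subst (λ z → Adj G z s) (sym (path-last path)) (Adj-sym s~y)
      }
      where
      cyc = s ∷ x ∷ w ∷ rest
      injective : ∀ i j → lookup cyc i ≡ lookup cyc j → i ≡ j
      injective fzero fzero _ = refl
      injective fzero (fsuc j) s≡ = ⊥-elim (path-avoids path (∈-lookup j) (sym s≡))
      injective (fsuc i) fzero ≡s = ⊥-elim (path-avoids path (∈-lookup i) ≡s)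
      injective (fsuc i) (fsuc j) eq = cong fsuc (path-injective path i j eq)
      edges : (i : Fin (suc (suc (length rest)))) → Adj G (lookup cyc (inject₁ i)) (lookup cyc (fsuc i))
      edges fzero = s~x
      edges (fsuc i) = path-edge path i

    branch-unique : IsTree G → Adj G s x → Adj G s y → Branch s x v → Branch s y v → x ≡ y
    branch-unique {x} {y} (_ , acyclic) s~x s~y x⇝v y⇝v with x ≟ y
    ... | yes x≡y = x≡y
    ... | no x≢y = ⊥-elim (acyclic (cycle x≢y s~x s~y (proj₂ (loop-erase (x⇝v ++ reverse y⇝v)))))

    last-exit : ∀ {k} → Walk G u v k → v ≢ s → (∃ λ c → Adj G s c × Branch s c v) ⊎ AvoidingWalk s u v
    last-exit here v≢s = inj₂ [ v≢s ]
    last-exit (step {u} u~w walk) v≢s with last-exit walk v≢s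
    ... | inj₁ exit = inj₁ exit
    ... | inj₂ w⇝v with u ≟ s
    ...   | yes refl = inj₁ (_ , u~w , w⇝v)
    ...   | no u≢s = inj₂ (cons u≢s u~w w⇝v)

    branch-of : Connected G → v ≢ s → ∃ λ c → Adj G s c × Branch s c v
    branch-of {v} connected v≢s with last-exit (proj₂ (connected s v)) v≢s
    ... | inj₁ exit = exit
    ... | inj₂ (cons s≢s _ _) = ⊥-elim (s≢s refl)
    ... | inj₂ [ s≢s ] = ⊥-elim (s≢s refl)

    branch? : IsTree G → Adj G s x → Decidable (Branch s x)
    branch? {x} tree s~x v with v ≟ s
    ... | yes refl = no λ x⇝s → end≢s x⇝s refl
    ... | no v≢s with branch-of (proj₁ tree) v≢s
    ...   | c , s~c , c⇝v with c ≟ x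
    ...     | yes refl = yes c⇝v
    ...     | no c≢x = no λ x⇝v → c≢x (branch-unique tree s~c s~x c⇝v x⇝v)

  common-neighbour-unique : IsTree G → x ≢ y → Adj G x u → Adj G u y → Adj G x w → Adj G w y → u ≡ w
  common-neighbour-unique tree x≢y x~u u~y x~w w~y =
    branch-unique tree x~u x~w (cons (Adj⇒≢ x~u ∘ sym) u~y [ x≢y ∘ sym ]) (cons (Adj⇒≢ x~w ∘ sym) w~y [ x≢y ∘ sym ])

  neighbour-not-adjacent : IsTree G → v ≢ z → Adj G v u → Adj G v w → u ≢ w → ∃ λ t → Adj G v t × ¬ Adj G z t
  neighbour-not-adjacent {v} {z} {u} {w} tree v≢z v~u v~w u≢w with Adj? z u | Adj? z w
  ... | no ¬z~u | _ = u , v~u , ¬z~u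
  ... | yes _ | no ¬z~w = w , v~w , ¬z~w
  ... | yes z~u | yes z~w = ⊥-elim (u≢w (common-neighbour-unique tree v≢z v~u (Adj-sym z~u) v~w (Adj-sym z~w)))

module Colouring (G : Graph) (col : Vertex G → Bool) (proper : ProperColouring G col) where
  open Graph G using (n)
  open Neighbours G
  open Domination G
  open Branches G using (neighbour-not-adjacent)

  private
    V = Vertex G
    variable
      u v w x z : V
      D D₁ D₂ : Subset n

  Blue : Pred V 0ℓ
  Blue v = col v ≡ false

  Red? : Decidable (Red G col)
  Red? v = col v ≟ᵇ true

  Blue? : Decidable Blue
  Blue? v = col v ≟ᵇ false

  red-or-blue : ∀ v → Red G col v ⊎ Blue v
  red-or-blue v with col v
  ... | true = inj₁ refl
  ... | false = inj₂ refl

  red⇒¬blue : Red G col v → ¬ Blue v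
  red⇒¬blue red blue with trans (sym red) blue
  ... | ()

  red-blue⇒≢ : Red G col u → Blue v → u ≢ v
  red-blue⇒≢ red blue refl = red⇒¬blue red blue

  red-neighbour⇒blue : Adj G u v → Red G col u → Blue v
  red-neighbour⇒blue {u} {v} u~v red with col v in col-v
  ... | false = refl
  ... | true = ⊥-elim (proper u v u~v (trans red (sym col-v)))

  blue-neighbour⇒red : Adj G u v → Blue u → Red G col v
  blue-neighbour⇒red {u} {v} u~v blue with col v in col-v
  ... | true = refl
  ... | false = ⊥-elim (proper u v u~v (trans blue (sym col-v)))

  red⇒neighbour-not-adjacent : IsTree G → (∀ v → Leaf G v → Blue v) → Blue w →
                           Red G col v → v ≢ z → ∃ λ u → Adj G v u × ¬ Adj G z u
  red⇒neighbour-not-adjacent tree leaves-blue blue-w red-v v≢z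
    with connected⇒neighbour (proj₁ tree) (red-blue⇒≢ red-v blue-w)
  ... | u , v~u with ¬leaf⇒other-neighbour (red⇒¬blue red-v ∘ leaves-blue _) v~u
  ...   | u' , v~u' , u'≢u = neighbour-not-adjacent tree v≢z v~u v~u' (u'≢u ∘ sym)

  record IrredundantRDS (D : Subset n) : Set where
    field
      blue : ∀ {x} → x ∈ D → Blue x
      dominates : Dominates D (Red G col)
      irredundant : Irredundant (Red G col) D

  irredundant⇒minimal-rds : IrredundantRDS D → IsMinimalRDS G col D
  irredundant⇒minimal-rds rds =
    (λ v → mk⇔ (λ (u , u∈D , u~v) → blue-neighbour⇒red u~v (blue u∈D)) dominates) ,
    λ D' D'⊂D same → irredundant⇒minimal irredundant D'⊂D (λ v → Equivalence.from (same v))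
    where open IrredundantRDS rds

  module _ {E : Subset n} (E-red : ∀ {x} → x ∈ E → Red G col x)
           (E-dominates : Dominates E Blue) (E-irredundant : Irredundant Blue E) where

    rds-∪-minimal-tds : IrredundantRDS D → IsMinimalTDS G (D ∪ E)
    rds-∪-minimal-tds {D} rds = total , λ S' S'⊂D∪E tds → irredundant⇒minimal irredundant-∪ S'⊂D∪E (λ v _ → tds v)
      where
      open IrredundantRDS rds
      total : IsTDS G (D ∪ E)
      total v with red-or-blue v
      ... | inj₁ red = InN-mono (p⊆p∪q E) (dominates red)
      ... | inj₂ blue = InN-mono (q⊆p∪q D E) (E-dominates blue)
      irredundant-∪ : Irredundant U (D ∪ E)
      irredundant-∪ x∈D∪E with x∈p∪q⁻ D E x∈D∪E
      ... | inj₁ x∈D = let p , red-p , p-private = irredundant x∈D in p , _ , private-transfer p-private (only-D red-p)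
        where
        only-D : ∀ {p y} → Red G col p → y ∈ D ∪ E → Adj G y p → y ∈ D
        only-D red-p y∈D∪E y~p with x∈p∪q⁻ D E y∈D∪E
        ... | inj₁ y∈D = y∈D
        ... | inj₂ y∈E = ⊥-elim (red⇒¬blue red-p (red-neighbour⇒blue y~p (E-red y∈E)))
      ... | inj₂ x∈E = let p , blue-p , p-private = E-irredundant x∈E in p , _ , private-transfer p-private (only-E blue-p)
        where
        only-E : ∀ {p y} → Blue p → y ∈ D ∪ E → Adj G y p → y ∈ E
        only-E blue-p y∈D∪E y~p with x∈p∪q⁻ D E y∈D∪E
        ... | inj₂ y∈E = y∈E
        ... | inj₁ y∈D = ⊥-elim (red⇒¬blue (blue-neighbour⇒red y~p (blue y∈D)) blue-p)

    ∣rds-∪∣ : IrredundantRDS D → ∣ D ∪ E ∣ ≡ ∣ D ∣ + ∣ E ∣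
    ∣rds-∪∣ {D} rds = ∣p∪q∣≡∣p∣+∣q∣ D E λ x∈D x∈E → red⇒¬blue (E-red x∈E) (IrredundantRDS.blue rds x∈D)

  blue-dominated-by-red : Connected G → Red G col u → Dominates (subset Red?) Blue
  blue-dominated-by-red connected red-u blue-q with connected⇒neighbour connected (red-blue⇒≢ red-u blue-q ∘ sym)
  ... | v , q~v = v , ∈-subset⁺ Red? (blue-neighbour⇒red q~v blue-q) , Adj-sym q~v

  ¬well-totally-dominated : Connected G → Red G col u →
                            IrredundantRDS D₁ → IrredundantRDS D₂ → ∣ D₁ ∣ ≢ ∣ D₂ ∣ → ¬ WellTotallyDominated G
  ¬well-totally-dominated {D₁ = D₁} {D₂} connected red-u rds₁ rds₂ ∣D₁∣≢∣D₂∣ wtd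
    with irredundant-subset Blue? (subset Red?) (blue-dominated-by-red connected red-u)
  ... | E , E⊆red , E-dominates , E-irredundant = ∣D₁∣≢∣D₂∣ (+-cancelʳ-≡ _ _ _ (begin
    ∣ D₁ ∣ + ∣ E ∣  ≡⟨ sym (∣rds-∪∣ E-red E-dominates E-irredundant rds₁) ⟩
    ∣ D₁ ∪ E ∣      ≡⟨ wtd _ _ (minimal-tds rds₁) (minimal-tds rds₂) ⟩
    ∣ D₂ ∪ E ∣      ≡⟨ ∣rds-∪∣ E-red E-dominates E-irredundant rds₂ ⟩
    ∣ D₂ ∣ + ∣ E ∣  ∎))
    where
    E-red : ∀ {x} → x ∈ E → Red G col x
    E-red = ∈-subset⁻ Red? ∘ E⊆red
    minimal-tds : IrredundantRDS D → IsMinimalTDS G (D ∪ E)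
    minimal-tds = rds-∪-minimal-tds E-red E-dominates E-irredundant
    open ≡-Reasoning

  unequal-rds⇒¬well-totally-dominated : Connected G → Red G col u → UnequalPair IrredundantRDS →
                                         UnequalPair (IsMinimalRDS G col) × ¬ WellTotallyDominated G
  unequal-rds⇒¬well-totally-dominated connected red-u (D₁ , D₂ , rds₁ , rds₂ , ∣D₁∣≢∣D₂∣) =
    (D₁ , D₂ , irredundant⇒minimal-rds rds₁ , irredundant⇒minimal-rds rds₂ , ∣D₁∣≢∣D₂∣) ,
    ¬well-totally-dominated connected red-u rds₁ rds₂ ∣D₁∣≢∣D₂∣

module TwoBranches (G : Graph) (tree : IsTree G) (col : Vertex G → Bool) (proper : ProperColouring G col)
                   (leaves-blue : ∀ v → Leaf G v → col v ≡ false)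
                   {s ℓ a b : Vertex G} (s~ℓ : Adj G s ℓ) (ℓ-leaf : Leaf G ℓ)
                   (s~a : Adj G s a) (s~b : Adj G s b) (a≢b : a ≢ b) (a-inner : ¬ Leaf G a) (b-inner : ¬ Leaf G b)
                   where
  open Graph G using (n)
  open Neighbours G
  open Domination G
  open Branches G
  open Colouring G col proper

  private
    V = Vertex G
    variable
      q x : V
      P S : Subset n
      R K : Pred V 0ℓ

  ℓ-blue : Blue ℓ
  ℓ-blue = leaves-blue ℓ ℓ-leaf

  s-red : Red G col s
  s-red = blue-neighbour⇒red (Adj-sym s~ℓ) ℓ-blue

  blue⇒≢s : Blue x → x ≢ s
  blue⇒≢s blue = red-blue⇒≢ s-red blue ∘ sym

  Closed : Pred V 0ℓ → Set
  Closed R = ∀ {u v} → Adj G u v → u ≢ s → v ≢ s → R u → R v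

  -- s is left out of every zone: it is dominated by a, b or ℓ, according to how parts are combined.
  Zone : Pred V 0ℓ → Pred V 0ℓ
  Zone R q = Red G col q × q ≢ s × R q

  record Part (R : Pred V 0ℓ) (P : Subset n) : Set where
    field
      blue : ∀ {x} → x ∈ P → Blue x
      within : ∀ {x} → x ∈ P → R x
      dominates : Dominates P (Zone R)
      irredundant : Irredundant (Zone R) P

  part : Decidable R → Closed R → Decidable K → (∀ {q} → Zone R q → ∃ λ u → Adj G u q × K u) →
         ∃ λ P → Part R P × (∀ {x} → x ∈ P → K x)
  part {R} {K} R? closed K? K-neighbour = minimise (irredundant-subset zone? (subset candidate?) candidates-dominate)
    where
    zone? : Decidable (Zone R)
    zone? q = Red? q ×-dec ¬? (q ≟ s) ×-dec R? q
    candidate? : Decidable (λ u → Blue u × R u × K u)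
    candidate? u = Blue? u ×-dec R? u ×-dec K? u
    candidates-dominate : Dominates (subset candidate?) (Zone R)
    candidates-dominate zone@(red-q , q≢s , Rq) with K-neighbour zone
    ... | u , u~q , Ku = u , ∈-subset⁺ candidate? (blue-u , closed (Adj-sym u~q) q≢s (blue⇒≢s blue-u) Rq , Ku) , u~q
      where
      blue-u = red-neighbour⇒blue (Adj-sym u~q) red-q
    minimise : (∃ λ P → P ⊆ subset candidate? × Dominates P (Zone R) × Irredundant (Zone R) P) →
               ∃ λ P → Part R P × (∀ {x} → x ∈ P → K x)
    minimise (P , P⊆S , dominates , irredundant) =
      P , record { blue = proj₁ ∘ member ; within = proj₁ ∘ proj₂ ∘ member
                 ; dominates = dominates ; irredundant = irredundant } , proj₂ ∘ proj₂ ∘ member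
      where
      member : x ∈ P → Blue x × R x × K x
      member = ∈-subset⁻ candidate? ∘ P⊆S

  neighbour-missing-s : Red G col q → q ≢ s → ∃ λ u → Adj G u q × ¬ Adj G u s
  neighbour-missing-s red-q q≢s =
    let u , q~u , ¬s~u = red⇒neighbour-not-adjacent tree leaves-blue ℓ-blue red-q q≢s in u , Adj-sym q~u , ¬s~u ∘ Adj-sym

  part-missing-s : Decidable R → Closed R → ∃ λ P → Part R P × ¬ InN G P s
  part-missing-s R? closed
    with part R? closed (λ u → ¬? (Adj? u s)) (λ (red-q , q≢s , _) → neighbour-missing-s red-q q≢s)
  ... | P , P-part , misses-s = P , P-part , λ (x , x∈P , x~s) → misses-s x∈P x~s

  branch-closed : Closed (Branch s x)
  branch-closed u~v _ v≢s x⇝u = extend x⇝u u~v v≢s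

  part-containing : Adj G s x → ¬ Leaf G x → ∃ λ P → Part (Branch s x) P × x ∈ P
  part-containing {x} s~x x-inner with ¬leaf⇒other-neighbour x-inner (Adj-sym s~x)
  ... | t , x~t , t≢s = contains-x (part (branch? tree s~x) branch-closed avoids-t? avoiding-t-neighbour)
    where
    AvoidsT : Pred V 0ℓ
    AvoidsT u = ¬ Adj G t u ⊎ u ≡ x
    avoids-t? : Decidable AvoidsT
    avoids-t? u = ¬? (Adj? t u) ⊎-dec (u ≟ x)
    x-blue : Blue x
    x-blue = red-neighbour⇒blue s~x s-red
    t-zone : Zone (Branch s x) t
    t-zone = blue-neighbour⇒red x~t x-blue , t≢s , cons (Adj⇒≢ s~x ∘ sym) x~t [ t≢s ]
    avoiding-t-neighbour : Zone (Branch s x) q → ∃ λ u → Adj G u q × AvoidsT u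
    avoiding-t-neighbour {q} (red-q , _ , _) with q ≟ t
    ... | yes refl = x , x~t , inj₂ refl
    ... | no q≢t = let u , q~u , ¬t~u = red⇒neighbour-not-adjacent tree leaves-blue ℓ-blue red-q q≢t in u , Adj-sym q~u , inj₁ ¬t~u
    -- x is the only candidate adjacent to t, so it is kept to dominate t.
    contains-x : (∃ λ P → Part (Branch s x) P × (∀ {y} → y ∈ P → AvoidsT y)) → ∃ λ P → Part (Branch s x) P × x ∈ P
    contains-x (P , P-part , avoids-t) with Part.dominates P-part t-zone
    ... | y , y∈P , y~t with avoids-t y∈P
    ...   | inj₁ ¬t~y = ⊥-elim (¬t~y (Adj-sym y~t))
    ...   | inj₂ refl = P , P-part , y∈P

  Rest : Pred V 0ℓ
  Rest v = ¬ Branch s a v × ¬ Branch s b v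

  rest? : Decidable Rest
  rest? v = ¬? (branch? tree s~a v) ×-dec ¬? (branch? tree s~b v)

  rest-closed : Closed Rest
  rest-closed u~v u≢s _ (∉a , ∉b) = (λ a⇝v → ∉a (extend a⇝v (Adj-sym u~v) u≢s)) ,
                                    (λ b⇝v → ∉b (extend b⇝v (Adj-sym u~v) u≢s))

  branches-disjoint : Branch s a x → ¬ Branch s b x
  branches-disjoint a⇝x b⇝x = a≢b (branch-unique tree s~a s~b a⇝x b⇝x)

  ℓ-rest : Rest ℓ
  ℓ-rest = ℓ∉branch s~a a-inner , ℓ∉branch s~b b-inner
    where
    ℓ∉branch : Adj G s x → ¬ Leaf G x → ¬ Branch s x ℓ
    ℓ∉branch s~x x-inner x⇝ℓ =
      x-inner (subst (Leaf G) (branch-unique tree s~ℓ s~x [ Adj⇒≢ s~ℓ ∘ sym ] x⇝ℓ) ℓ-leaf)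

  -- A zone vertex has all its blue neighbours in the region, where S agrees with P
  -- except possibly at ℓ, whose only neighbour is s.
  private-in-part : Part R P → Closed R → (∀ {y} → y ∈ S → Blue y) → (∀ {y} → y ∈ S → R y → y ∈ P ⊎ y ≡ ℓ) →
                    x ∈ P → ∃ λ p → Red G col p × PrivateNeighbour S x p
  private-in-part {S = S} {x = x} P-part closed S-blue local x∈P with Part.irredundant P-part x∈P
  ... | p , (red-p , p≢s , Rp) , x~p , only = p , red-p , x~p , only-x
    where
    only-x : ∀ y → y ∈ S → Adj G y p → y ≡ x
    only-x y y∈S y~p with local y∈S (closed (Adj-sym y~p) p≢s (blue⇒≢s (S-blue y∈S)) Rp)
    ... | inj₁ y∈P = only y y∈P y~p
    ... | inj₂ refl = ⊥-elim (p≢s (leaf-neighbour-unique ℓ-leaf (Adj-sym s~ℓ) y~p))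

  module Assembly {A B W : Subset n} (L : Subset n)
                  (A-part : Part (Branch s a) A) (B-part : Part (Branch s b) B) (W-part : Part Rest W)
                  (W-misses-s : ¬ InN G W s) (L⊆⁅ℓ⁆ : ∀ {x} → x ∈ L → x ≡ ℓ) where
    private
      module A = Part A-part
      module B = Part B-part
      module W = Part W-part

    D : Subset n
    D = A ∪ B ∪ W ∪ L

    A⊆D : A ⊆ D
    A⊆D = p⊆p∪q (B ∪ W ∪ L)

    B⊆D : B ⊆ D
    B⊆D = q⊆p∪q A _ ∘ p⊆p∪q (W ∪ L)

    W⊆D : W ⊆ D
    W⊆D = q⊆p∪q A _ ∘ q⊆p∪q B _ ∘ p⊆p∪q L

    L⊆D : L ⊆ D
    L⊆D = q⊆p∪q A _ ∘ q⊆p∪q B _ ∘ q⊆p∪q W L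

    ∈D⁻ : x ∈ D → x ∈ A ⊎ x ∈ B ⊎ x ∈ W ⊎ x ∈ L
    ∈D⁻ x∈D = Sum.map₂ (Sum.map₂ (x∈p∪q⁻ W L) ∘ x∈p∪q⁻ B (W ∪ L)) (x∈p∪q⁻ A (B ∪ W ∪ L) x∈D)

    ∉W∪L-branch : x ∈ W ∪ L → ¬ Branch s a x × ¬ Branch s b x
    ∉W∪L-branch x∈W∪L with x∈p∪q⁻ W L x∈W∪L
    ... | inj₁ x∈W = W.within x∈W
    ... | inj₂ x∈L = subst Rest (sym (L⊆⁅ℓ⁆ x∈L)) ℓ-rest

    ∉B∪W∪L-branch-a : x ∈ B ∪ W ∪ L → ¬ Branch s a x
    ∉B∪W∪L-branch-a x∈B∪W∪L a⇝x with x∈p∪q⁻ B (W ∪ L) x∈B∪W∪L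
    ... | inj₁ x∈B = branches-disjoint a⇝x (B.within x∈B)
    ... | inj₂ x∈W∪L = proj₁ (∉W∪L-branch x∈W∪L) a⇝x

    blue : x ∈ D → Blue x
    blue x∈D with ∈D⁻ x∈D
    ... | inj₁ x∈A = A.blue x∈A
    ... | inj₂ (inj₁ x∈B) = B.blue x∈B
    ... | inj₂ (inj₂ (inj₁ x∈W)) = W.blue x∈W
    ... | inj₂ (inj₂ (inj₂ x∈L)) = subst Blue (sym (L⊆⁅ℓ⁆ x∈L)) ℓ-blue

    dominates : InN G D s → Dominates D (Red G col)
    dominates s-dominated {r} red-r with r ≟ s
    ... | yes refl = s-dominated
    ... | no r≢s with branch? tree s~a r | branch? tree s~b r
    ...   | yes a⇝r | _ = InN-mono A⊆D (A.dominates (red-r , r≢s , a⇝r))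
    ...   | no _ | yes b⇝r = InN-mono B⊆D (B.dominates (red-r , r≢s , b⇝r))
    ...   | no ∉a | no ∉b = InN-mono W⊆D (W.dominates (red-r , r≢s , ∉a , ∉b))

    local-A : x ∈ D → Branch s a x → x ∈ A ⊎ x ≡ ℓ
    local-A x∈D a⇝x with x∈p∪q⁻ A _ x∈D
    ... | inj₁ x∈A = inj₁ x∈A
    ... | inj₂ x∈B∪W∪L = ⊥-elim (∉B∪W∪L-branch-a x∈B∪W∪L a⇝x)

    local-B : x ∈ D → Branch s b x → x ∈ B ⊎ x ≡ ℓ
    local-B x∈D b⇝x with ∈D⁻ x∈D
    ... | inj₁ x∈A = ⊥-elim (branches-disjoint (A.within x∈A) b⇝x)
    ... | inj₂ (inj₁ x∈B) = inj₁ x∈B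
    ... | inj₂ (inj₂ x∈W∪L) = ⊥-elim (proj₂ (∉W∪L-branch (x∈p∪q⁺ x∈W∪L)) b⇝x)

    local-W : x ∈ D → Rest x → x ∈ W ⊎ x ≡ ℓ
    local-W x∈D (∉a , ∉b) with ∈D⁻ x∈D
    ... | inj₁ x∈A = ⊥-elim (∉a (A.within x∈A))
    ... | inj₂ (inj₁ x∈B) = ⊥-elim (∉b (B.within x∈B))
    ... | inj₂ (inj₂ (inj₁ x∈W)) = inj₁ x∈W
    ... | inj₂ (inj₂ (inj₂ x∈L)) = inj₂ (L⊆⁅ℓ⁆ x∈L)

    irredundant-rds : InN G D s → (∀ {x} → x ∈ L → ∃ λ p → Red G col p × PrivateNeighbour D x p) → IrredundantRDS D
    irredundant-rds s-dominated L-private = record { blue = blue ; dominates = dominates s-dominated ; irredundant = irredundant }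
      where
      irredundant : Irredundant (Red G col) D
      irredundant x∈D with ∈D⁻ x∈D
      ... | inj₁ x∈A = private-in-part A-part branch-closed blue local-A x∈A
      ... | inj₂ (inj₁ x∈B) = private-in-part B-part branch-closed blue local-B x∈B
      ... | inj₂ (inj₂ (inj₁ x∈W)) = private-in-part W-part rest-closed blue local-W x∈W
      ... | inj₂ (inj₂ (inj₂ x∈L)) = L-private x∈L

    ℓ-private : ¬ InN G A s → ¬ InN G B s → x ∈ L → ∃ λ p → Red G col p × PrivateNeighbour D x p
    ℓ-private A-misses-s B-misses-s x∈L with L⊆⁅ℓ⁆ x∈L
    ... | refl = s , s-red , Adj-sym s~ℓ , only-ℓ
      where
      only-ℓ : ∀ y → y ∈ D → Adj G y s → y ≡ ℓ
      only-ℓ y y∈D y~s with ∈D⁻ y∈D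
      ... | inj₁ y∈A = ⊥-elim (A-misses-s (y , y∈A , y~s))
      ... | inj₂ (inj₁ y∈B) = ⊥-elim (B-misses-s (y , y∈B , y~s))
      ... | inj₂ (inj₂ (inj₁ y∈W)) = ⊥-elim (W-misses-s (y , y∈W , y~s))
      ... | inj₂ (inj₂ (inj₂ y∈L)) = L⊆⁅ℓ⁆ y∈L

    ∣D∣ : ∣ D ∣ ≡ ∣ A ∣ + (∣ B ∣ + (∣ W ∣ + ∣ L ∣))
    ∣D∣ = begin
      ∣ A ∪ B ∪ W ∪ L ∣              ≡⟨ ∣p∪q∣≡∣p∣+∣q∣ A _ (λ x∈A → flip ∉B∪W∪L-branch-a (A.within x∈A)) ⟩
      ∣ A ∣ + ∣ B ∪ W ∪ L ∣           ≡⟨ cong (∣ A ∣ +_) (∣p∪q∣≡∣p∣+∣q∣ B _ λ x∈B x∈W∪L → proj₂ (∉W∪L-branch x∈W∪L) (B.within x∈B)) ⟩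
      ∣ A ∣ + (∣ B ∣ + ∣ W ∪ L ∣)     ≡⟨ cong (λ m → ∣ A ∣ + (∣ B ∣ + m)) (∣p∪q∣≡∣p∣+∣q∣ W L W-∉L) ⟩
      ∣ A ∣ + (∣ B ∣ + (∣ W ∣ + ∣ L ∣)) ∎
      where
      open ≡-Reasoning
      W-∉L : x ∈ W → x ∉ L
      W-∉L x∈W x∈L with L⊆⁅ℓ⁆ x∈L
      ... | refl = W-misses-s (ℓ , x∈W , Adj-sym s~ℓ)

  rds-of-different-sizes : UnequalPair IrredundantRDS
  rds-of-different-sizes
    with part-containing s~a a-inner | part-missing-s (branch? tree s~a) branch-closed
       | part-containing s~b b-inner | part-missing-s (branch? tree s~b) branch-closed
       | part-missing-s rest? rest-closed
  ... | Xa , Xa-part , a∈Xa | Ya , Ya-part , Ya-misses-s | Xb , Xb-part , b∈Xb | Yb , Yb-part , Yb-misses-s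
      | W , W-part , W-misses-s =
    unequal-pair
      (XX.irredundant-rds (a , XX.A⊆D a∈Xa , Adj-sym s~a) ∉⊥-private)
      (XY.irredundant-rds (a , XY.A⊆D a∈Xa , Adj-sym s~a) ∉⊥-private)
      (YX.irredundant-rds (b , YX.B⊆D b∈Xb , Adj-sym s~b) ∉⊥-private)
      (YY.irredundant-rds (ℓ , YY.L⊆D (x∈⁅x⁆ ℓ) , Adj-sym s~ℓ) (YY.ℓ-private Ya-misses-s Yb-misses-s))
      sizes
    where
    module XX = Assembly ⊥ Xa-part Xb-part W-part W-misses-s (⊥-elim ∘ ∉⊥)
    module XY = Assembly ⊥ Xa-part Yb-part W-part W-misses-s (⊥-elim ∘ ∉⊥)
    module YX = Assembly ⊥ Ya-part Xb-part W-part W-misses-s (⊥-elim ∘ ∉⊥)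
    module YY = Assembly ⁅ ℓ ⁆ Ya-part Yb-part W-part W-misses-s (x∈⁅y⁆⇒x≡y ℓ)
    ∉⊥-private : ∀ {D x} → x ∈ ⊥ → ∃ λ p → Red G col p × PrivateNeighbour D x p
    ∉⊥-private = ⊥-elim ∘ ∉⊥
    ∣⁅ℓ⁆∣≡1+∣⊥∣ : ∣ ⁅ ℓ ⁆ ∣ ≡ suc ∣ ⊥ {n} ∣
    ∣⁅ℓ⁆∣≡1+∣⊥∣ = trans (∣⁅x⁆∣≡1 ℓ) (cong suc (sym (∣⊥∣≡0 n)))
    sizes : ∣ XX.D ∣ + ∣ YY.D ∣ ≡ suc (∣ XY.D ∣ + ∣ YX.D ∣)
    sizes = begin
      ∣ XX.D ∣ + ∣ YY.D ∣
        ≡⟨ cong₂ _+_ XX.∣D∣ (trans YY.∣D∣ (cong (λ m → ∣ Ya ∣ + (∣ Yb ∣ + (∣ W ∣ + m))) ∣⁅ℓ⁆∣≡1+∣⊥∣)) ⟩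
      ∣ Xa ∣ + (∣ Xb ∣ + (∣ W ∣ + ∣ ⊥ {n} ∣)) + (∣ Ya ∣ + (∣ Yb ∣ + (∣ W ∣ + suc ∣ ⊥ {n} ∣)))
        ≡⟨ crossed-sums (∣ Xa ∣) (∣ Ya ∣) (∣ Xb ∣) (∣ Yb ∣) (∣ W ∣) (∣ ⊥ {n} ∣) ⟩
      suc (∣ Xa ∣ + (∣ Yb ∣ + (∣ W ∣ + ∣ ⊥ {n} ∣)) + (∣ Ya ∣ + (∣ Xb ∣ + (∣ W ∣ + ∣ ⊥ {n} ∣))))
        ≡⟨ cong suc (sym (cong₂ _+_ XY.∣D∣ YX.∣D∣)) ⟩
      suc (∣ XY.D ∣ + ∣ YX.D ∣) ∎
      where open ≡-Reasoning

theorem4p11 : (G : Graph) → IsTree G → Balanced G →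
    (col : Vertex G → Bool) → ProperColouring G col →
    (∀ v → Leaf G v → col v ≡ false) →
    (s : Vertex G) → HasHeight G s 1 → TwoHeight2Nbrs G s →
    (Σ (Subset (Graph.n G)) λ D₁ → Σ (Subset (Graph.n G)) λ D₂ →
       IsMinimalRDS G col D₁ × IsMinimalRDS G col D₂ × ∣ D₁ ∣ ≢ ∣ D₂ ∣)
    × ¬ WellTotallyDominated G
theorem4p11 G tree _ col proper leaves-blue s s-height (a , b , a≢b , s~a , s~b , a-height , b-height)
  with ℓ , ℓ-leaf , s~ℓ ← Neighbours.height-1⇒leaf-neighbour G s-height =
  unequal-rds⇒¬well-totally-dominated (proj₁ tree) s-red
    (TwoBranches.rds-of-different-sizes G tree col proper leaves-blue
      s~ℓ ℓ-leaf s~a s~b a≢b (positive-height⇒¬leaf a-height) (positive-height⇒¬leaf b-height))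
  where
  open Neighbours G using (Adj-sym; positive-height⇒¬leaf)
  open Colouring G col proper using (blue-neighbour⇒red; unequal-rds⇒¬well-totally-dominated)
  s-red : Red G col s
  s-red = blue-neighbour⇒red (Adj-sym s~ℓ) (leaves-blue ℓ ℓ-leaf)
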